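{- Let $\Delta_1,\dots,\Delta_r\subseteq M_{\mathbb R}$ and $\nabla_1,\dots,\nabla_r\subseteq N_{\mathbb R}$ be two centered nef-partitions dual to each other, and $\Delta:=\Delta_1+\dots+\Delta_r$. Then any non-zero lattice point of $\Delta^*$ is contained, for some $i\in\{1,\dots,r\}$, in a face of $\nabla_i$ that does not contain the origin. In particular \[\#(\Delta^*\cap N)=\#(\nabla_1\cap N)+\dots+\#(\nabla_r\cap N)-r+1.\]
   Context: $M\cong\mathbb{Z}^d$, $N$ dual lattice. $\Delta_1,\dots,\Delta_r$ are lattice polytopes each containing $0$ such that $\Delta=\Delta_1+\dots+\Delta_r$ is a $d$-dimensional reflexive polytope (it contains $0$ in its interior and $\Delta^*=\{y:\langle x,y\rangle\ge-1\ \forall x\in\Delta\}$ is a lattice polytope); this is a centered nef-partition, and its dual centered nef-partition is $\nabla_i=\{y\in N_{\mathbb R}:\langle x,y\rangle\ge-\delta_{ij}\ \forall x\in\Delta_j,\ \forall j\}$.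
   Formalization: The spaces $M_{\mathbb R}$ and $N_{\mathbb R}$ are replaced by ℚ^d, so Δ, $\Delta^*$, the polytopes $\nabla_i$ and their faces are taken over the rationals. -}

module Defs where

open import Data.Nat using (ℕ)
open import Data.Integer using (ℤ)
open import Data.Rational using (ℚ; 0ℚ; 1ℚ; _+_; _*_; -_; _≤_; _<_; ∣_∣; _/_)
import Data.Rational as Q
open import Data.Fin using (Fin; _≟_)
import Data.Vec
import Data.Nat
open import Data.Vec using (Vec; []; _∷_; replicate; zipWith; map; foldr; lookup)
open import Data.List using (List; length)
import Data.List as L
open import Data.List.Membership.Propositional using (_∈_)
open import Data.List.Relation.Unary.Unique.Propositional using (Unique)
open import Data.Product using (Σ; _×_; ∃; ∃-syntax)
open import Data.Sum using (_⊎_)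
open import Relation.Binary.PropositionalEquality using (_≡_; _≢_)
open import Relation.Nullary using (¬_; yes; no)
open import Function.Bundles using (_⇔_)

-- Lattice points of M ≅ ℤ^d (and of N ≅ ℤ^d), and rational points of M_ℚ, N_ℚ.
Pt : ℕ → Set
Pt d = Vec ℚ d

LPt : ℕ → Set
LPt d = Vec ℤ d

toℚ : ∀ {d} → LPt d → Pt d
toℚ = map (λ z → z Q./ 1)

zeroPt : ∀ {d} → Pt d
zeroPt = replicate _ 0ℚ

_⊕_ : ∀ {d} → Pt d → Pt d → Pt d
_⊕_ = zipWith _+_

scale : ∀ {d} → ℚ → Pt d → Pt d
scale c = map (c *_)

⟨_,_⟩ : ∀ {d} → Pt d → Pt d → ℚ
⟨ x , y ⟩ = foldr _ _+_ 0ℚ (zipWith _*_ x y)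

sumℚ : ∀ {k} → (Fin k → ℚ) → ℚ
sumℚ {k} f = foldr _ _+_ 0ℚ (Data.Vec.tabulate f)

sumPt : ∀ {d k} → (Fin k → Pt d) → Pt d
sumPt {d} {k} f = foldr _ _⊕_ zeroPt (Data.Vec.tabulate f)

-- A lattice polytope, given by a finite list of lattice points (its convex hull).
LatticePolytope : ℕ → Set
LatticePolytope d = List (LPt d)

_∈conv_ : ∀ {d} → Pt d → LatticePolytope d → Set
_∈conv_ {d} x V =
  ∃[ c ] ((∀ k → 0ℚ ≤ c k) × (sumℚ {length V} c ≡ 1ℚ)
         × (sumPt (λ k → scale (c k) (toℚ (L.lookup V k))) ≡ x))

_∈Msum_ : ∀ {d r} → Pt d → (Fin r → LatticePolytope d) → Set
_∈Msum_ {d} {r} x Δs = ∃[ xs ] ((∀ i → xs i ∈conv Δs i) × (sumPt {d} {r} xs ≡ x))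

ZeroInInterior : ∀ {d} → (Pt d → Set) → Set
ZeroInInterior {d} S =
  ∃[ ε ] ((0ℚ < ε) × (∀ (x : Pt d) → (∀ k → ∣ lookup x k ∣ ≤ ε) → S x))

_∈dual_ : ∀ {d r} → Pt d → (Fin r → LatticePolytope d) → Set
_∈dual_ {d} y Δs = ∀ (x : Pt d) → x ∈Msum Δs → - 1ℚ ≤ ⟨ x , y ⟩

IsReflexiveSum : ∀ {d r} → (Fin r → LatticePolytope d) → Set
IsReflexiveSum {d} Δs =
  ZeroInInterior (λ x → x ∈Msum Δs)
  × ∃[ W ] (∀ (y : Pt d) → (y ∈dual Δs) ⇔ (y ∈conv W))

IsCenteredNefPartition : ∀ {d r} → (Fin r → LatticePolytope d) → Set
IsCenteredNefPartition Δs = (∀ i → zeroPt ∈conv Δs i) × IsReflexiveSum Δs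

δ : ∀ {r} → Fin r → Fin r → ℚ
δ i j with i ≟ j
... | yes _ = 1ℚ
... | no _ = 0ℚ

_∈∇[_]_ : ∀ {d r} → Pt d → Fin r → (Fin r → LatticePolytope d) → Set
_∈∇[_]_ {d} y i Δs = ∀ j (x : Pt d) → x ∈conv Δs j → - δ i j ≤ ⟨ x , y ⟩

-- y lies in a face of ∇_i not containing the origin: there is a supporting
-- hyperplane ⟨·,u⟩ = c of ∇_i (⟨y',u⟩ ≥ c on ∇_i) through y with c ≠ 0,
-- i.e. the face ∇_i ∩ {⟨·,u⟩ = c} contains y but not 0.
InFaceAvoidingOrigin : ∀ {d r} → Pt d → Fin r → (Fin r → LatticePolytope d) → Set
InFaceAvoidingOrigin {d} y i Δs =
  (y ∈∇[ i ] Δs) ×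
  ∃[ u ] ∃[ c ] ((∀ (y' : Pt d) → y' ∈∇[ i ] Δs → c ≤ ⟨ y' , u ⟩)
                 × (⟨ y , u ⟩ ≡ c)
                 × (¬ (⟨ zeroPt , u ⟩ ≡ c)))

Enumerates : ∀ {d} → List (LPt d) → (Pt d → Set) → Set
Enumerates {d} Ls S = Unique Ls × (∀ (y : LPt d) → (y ∈ Ls) ⇔ S (toℚ y))

sumℕ : ∀ {k} → (Fin k → ℕ) → ℕ
sumℕ f = foldr _ Data.Nat._+_ 0 (Data.Vec.tabulate f)

-- For a lattice point y of Δ* let m_j be the minimum of ⟨·, y⟩ over the vertices of Δ_j.
-- Each m_j is an integer, m_j ≤ 0 because 0 ∈ Δ_j, and Σ m_j ≥ -1 because the sum of the
-- minimising vertices lies in Δ. So either every m_j vanishes, and then ⟨·, y⟩ ≥ 0 on Δ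
-- forces y = 0 since 0 is interior to Δ; or m_i = -1 for exactly one i and m_j = 0 otherwise,
-- which says that y ∈ ∇_i and that the minimising vertex v_i of Δ_i cuts out the face
-- {⟨v_i, ·⟩ = -1} of ∇_i through y. The same bounds show ∇_i ⊆ Δ* and ∇_i ∩ ∇_j = {0} for
-- i ≠ j, so the lattice points of Δ* are 0 together with the disjoint union of the sets
-- (∇_i ∩ N) ∖ {0}, which gives the count.
module Submission where

open import Defs
open import Data.Nat using (ℕ; zero; suc)
open import Data.Fin using (Fin; zero; suc; _≟_)
open import Data.List using (List; []; _∷_; length)
import Data.List as List
open import Data.Vec using ([]; _∷_; replicate; lookup)
open import Data.Integer using (ℤ)
open import Data.Product using (_×_; _,_; proj₁; proj₂; ∃-syntax)
open import Data.Sum using (_⊎_; inj₁; inj₂)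
open import Data.Empty using (⊥; ⊥-elim)
open import Relation.Binary.PropositionalEquality
open import Relation.Binary.Definitions using (DecidableEquality)
open import Relation.Nullary using (¬_; yes; no)
open import Function using (_∘_)

-- The pairing, finite sums and convex hulls
module _ where
  open import Data.Rational using (ℚ; 0ℚ; 1ℚ; _+_; _*_; -_; _≤_; _<_; ∣_∣; Positive; positive; nonNegative)
  import Data.Rational.Properties as ℚ
  open import Algebra.Bundles using (CommutativeMonoid)
  open import Algebra.Properties.CommutativeSemigroup
    (CommutativeMonoid.commutativeSemigroup ℚ.+-0-commutativeMonoid) using (interchange)
  open import Algebra.Properties.Group ℚ.+-0-group using (⁻¹-involutive)
  open import Data.Vec.Properties using (tabulate-cong; lookup-replicate)

  ⟨⟩-comm : ∀ {d} (x y : Pt d) → ⟨ x , y ⟩ ≡ ⟨ y , x ⟩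
  ⟨⟩-comm [] [] = refl
  ⟨⟩-comm (a ∷ x) (b ∷ y) = cong₂ _+_ (ℚ.*-comm a b) (⟨⟩-comm x y)

  ⟨⟩-zeroˡ : ∀ {d} (y : Pt d) → ⟨ zeroPt , y ⟩ ≡ 0ℚ
  ⟨⟩-zeroˡ [] = refl
  ⟨⟩-zeroˡ (b ∷ y) = trans (cong₂ _+_ (ℚ.*-zeroˡ b) (⟨⟩-zeroˡ y)) (ℚ.+-identityˡ 0ℚ)

  ⟨⟩-zeroʳ : ∀ {d} (x : Pt d) → ⟨ x , zeroPt ⟩ ≡ 0ℚ
  ⟨⟩-zeroʳ x = trans (⟨⟩-comm x zeroPt) (⟨⟩-zeroˡ x)

  ⟨⟩-⊕ˡ : ∀ {d} (x z y : Pt d) → ⟨ x ⊕ z , y ⟩ ≡ ⟨ x , y ⟩ + ⟨ z , y ⟩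
  ⟨⟩-⊕ˡ [] [] [] = sym (ℚ.+-identityˡ 0ℚ)
  ⟨⟩-⊕ˡ (a ∷ x) (c ∷ z) (b ∷ y) = begin
    (a + c) * b + ⟨ x ⊕ z , y ⟩               ≡⟨ cong₂ _+_ (ℚ.*-distribʳ-+ b a c) (⟨⟩-⊕ˡ x z y) ⟩
    (a * b + c * b) + (⟨ x , y ⟩ + ⟨ z , y ⟩) ≡⟨ interchange (a * b) (c * b) _ _ ⟩
    (a * b + ⟨ x , y ⟩) + (c * b + ⟨ z , y ⟩) ∎
    where open ≡-Reasoning

  ⟨⟩-scaleˡ : ∀ {d} (c : ℚ) (x y : Pt d) → ⟨ scale c x , y ⟩ ≡ c * ⟨ x , y ⟩
  ⟨⟩-scaleˡ c [] [] = sym (ℚ.*-zeroʳ c)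
  ⟨⟩-scaleˡ c (a ∷ x) (b ∷ y) = begin
    c * a * b + ⟨ scale c x , y ⟩ ≡⟨ cong₂ _+_ (ℚ.*-assoc c a b) (⟨⟩-scaleˡ c x y) ⟩
    c * (a * b) + c * ⟨ x , y ⟩   ≡⟨ ℚ.*-distribˡ-+ c _ _ ⟨
    c * (a * b + ⟨ x , y ⟩)       ∎
    where open ≡-Reasoning

  ⟨⟩-sumPtˡ : ∀ {d k} (xs : Fin k → Pt d) (y : Pt d) → ⟨ sumPt xs , y ⟩ ≡ sumℚ (λ j → ⟨ xs j , y ⟩)
  ⟨⟩-sumPtˡ {k = zero} xs y = ⟨⟩-zeroˡ y
  ⟨⟩-sumPtˡ {k = suc k} xs y = trans (⟨⟩-⊕ˡ (xs zero) (sumPt (λ j → xs (suc j))) y)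
    (cong (⟨ xs zero , y ⟩ +_) (⟨⟩-sumPtˡ (λ j → xs (suc j)) y))

  scale-zero : ∀ {d} (x : Pt d) → scale 0ℚ x ≡ zeroPt
  scale-zero [] = refl
  scale-zero (a ∷ x) = cong₂ _∷_ (ℚ.*-zeroˡ a) (scale-zero x)

  scale-one : ∀ {d} (x : Pt d) → scale 1ℚ x ≡ x
  scale-one [] = refl
  scale-one (a ∷ x) = cong₂ _∷_ (ℚ.*-identityˡ a) (scale-one x)

  ⊕-identityˡ : ∀ {d} (x : Pt d) → zeroPt ⊕ x ≡ x
  ⊕-identityˡ [] = refl
  ⊕-identityˡ (a ∷ x) = cong₂ _∷_ (ℚ.+-identityˡ a) (⊕-identityˡ x)

  ⊕-identityʳ : ∀ {d} (x : Pt d) → x ⊕ zeroPt ≡ x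
  ⊕-identityʳ [] = refl
  ⊕-identityʳ (a ∷ x) = cong₂ _∷_ (ℚ.+-identityʳ a) (⊕-identityʳ x)

  sumℚ-cong : ∀ {k} {f g : Fin k → ℚ} → (∀ j → f j ≡ g j) → sumℚ f ≡ sumℚ g
  sumℚ-cong h = cong (Data.Vec.foldr _ _+_ 0ℚ) (tabulate-cong h)

  sumPt-cong : ∀ {d k} {f g : Fin k → Pt d} → (∀ j → f j ≡ g j) → sumPt f ≡ sumPt g
  sumPt-cong h = cong (Data.Vec.foldr _ _⊕_ zeroPt) (tabulate-cong h)

  sumℚ-mono-≤ : ∀ {k} {f g : Fin k → ℚ} → (∀ j → f j ≤ g j) → sumℚ f ≤ sumℚ g
  sumℚ-mono-≤ {zero} h = ℚ.≤-refl
  sumℚ-mono-≤ {suc k} h = ℚ.+-mono-≤ (h zero) (sumℚ-mono-≤ (λ j → h (suc j)))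

  sumℚ-zero : ∀ {k} → sumℚ {k} (λ _ → 0ℚ) ≡ 0ℚ
  sumℚ-zero {zero} = refl
  sumℚ-zero {suc k} = trans (cong (0ℚ +_) (sumℚ-zero {k})) (ℚ.+-identityˡ 0ℚ)

  sumℚ-*ʳ : ∀ {k} (f : Fin k → ℚ) (m : ℚ) → sumℚ (λ j → f j * m) ≡ sumℚ f * m
  sumℚ-*ʳ {zero} f m = sym (ℚ.*-zeroˡ m)
  sumℚ-*ʳ {suc k} f m = trans (cong (f zero * m +_) (sumℚ-*ʳ (λ j → f (suc j)) m))
    (sym (ℚ.*-distribʳ-+ m (f zero) _))

  sumℚ-neg : ∀ {k} (f : Fin k → ℚ) → sumℚ (λ j → - f j) ≡ - sumℚ f
  sumℚ-neg {zero} f = refl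
  sumℚ-neg {suc k} f = trans (cong (- f zero +_) (sumℚ-neg (λ j → f (suc j))))
    (sym (ℚ.neg-distrib-+ (f zero) _))

  sumPt-zero : ∀ {d k} (p : Fin k → Pt d) → sumPt (λ j → scale 0ℚ (p j)) ≡ zeroPt
  sumPt-zero {k = zero} p = refl
  sumPt-zero {k = suc k} p =
    trans (cong₂ _⊕_ (scale-zero (p zero)) (sumPt-zero (λ j → p (suc j)))) (⊕-identityˡ zeroPt)

  δ-diag : ∀ {r} (i : Fin r) → δ i i ≡ 1ℚ
  δ-diag i with i ≟ i
  ... | yes _ = refl
  ... | no i≢i = ⊥-elim (i≢i refl)

  δ-off : ∀ {r} {i j : Fin r} → ¬ i ≡ j → δ i j ≡ 0ℚ
  δ-off {i = i} {j} i≢j with i ≟ j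
  ... | yes i≡j = ⊥-elim (i≢j i≡j)
  ... | no _ = refl

  δ-suc : ∀ {r} (i j : Fin r) → δ (suc i) (suc j) ≡ δ i j
  δ-suc i j with i ≟ j
  ... | yes refl = refl
  ... | no _ = refl

  0≤δ : ∀ {r} (i j : Fin r) → 0ℚ ≤ δ i j
  0≤δ i j with i ≟ j
  ... | yes _ = ℚ.nonNegative⁻¹ 1ℚ
  ... | no _ = ℚ.≤-refl

  sumℚ-δ : ∀ {r} (i : Fin r) → sumℚ (δ i) ≡ 1ℚ
  sumℚ-δ {suc r} zero = trans (cong (1ℚ +_) (sumℚ-zero {r})) (ℚ.+-identityʳ 1ℚ)
  sumℚ-δ {suc r} (suc i) =
    trans (cong (0ℚ +_) (trans (sumℚ-cong (δ-suc i)) (sumℚ-δ i))) (ℚ.+-identityˡ 1ℚ)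

  sumPt-δ : ∀ {d r} (i : Fin r) (p : Fin r → Pt d) → sumPt (λ j → scale (δ i j) (p j)) ≡ p i
  sumPt-δ zero p =
    trans (cong₂ _⊕_ (scale-one (p zero)) (sumPt-zero (λ j → p (suc j)))) (⊕-identityʳ (p zero))
  sumPt-δ (suc i) p = trans (cong₂ _⊕_ (scale-zero (p zero)) shifted) (⊕-identityˡ (p (suc i)))
    where
    shifted : sumPt (λ j → scale (δ (suc i) (suc j)) (p (suc j))) ≡ p (suc i)
    shifted = trans (sumPt-cong (λ j → cong (λ c → scale c (p (suc j))) (δ-suc i j)))
                    (sumPt-δ i (λ j → p (suc j)))

  lookup∈conv : ∀ {d} (V : LatticePolytope d) (k : Fin (length V)) → toℚ (List.lookup V k) ∈conv V
  lookup∈conv V k = δ k , 0≤δ k , sumℚ-δ k , sumPt-δ k (λ j → toℚ (List.lookup V j))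

  someVertex : ∀ {d} {x : Pt d} (V : LatticePolytope d) → x ∈conv V → Fin (length V)
  someVertex [] (_ , _ , () , _)
  someVertex (_ ∷ _) _ = zero

  conv-lowerBound : ∀ {d} (V : LatticePolytope d) {y : Pt d} {m : ℚ} →
    (∀ k → m ≤ ⟨ toℚ (List.lookup V k) , y ⟩) → ∀ {x} → x ∈conv V → m ≤ ⟨ x , y ⟩
  conv-lowerBound V {y} {m} m≤vertices (c , c≥0 , Σc≡1 , refl) = begin
    m                                       ≡⟨ ℚ.*-identityˡ m ⟨
    1ℚ * m                                  ≡⟨ cong (_* m) Σc≡1 ⟨
    sumℚ c * m                              ≡⟨ sumℚ-*ʳ c m ⟨
    sumℚ (λ k → c k * m)                    ≤⟨ sumℚ-mono-≤ (λ k → c*-mono k (m≤vertices k)) ⟩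
    sumℚ (λ k → c k * ⟨ p k , y ⟩)          ≡⟨ sumℚ-cong (λ k → ⟨⟩-scaleˡ (c k) (p k) y) ⟨
    sumℚ (λ k → ⟨ scale (c k) (p k) , y ⟩)  ≡⟨ ⟨⟩-sumPtˡ (λ k → scale (c k) (p k)) y ⟨
    ⟨ sumPt (λ k → scale (c k) (p k)) , y ⟩ ∎
    where
    open ℚ.≤-Reasoning
    p : Fin (length V) → Pt _
    p k = toℚ (List.lookup V k)
    c*-mono : ∀ k {a b} → a ≤ b → c k * a ≤ c k * b
    c*-mono k = ℚ.*-monoˡ-≤-nonNeg (c k) {{nonNegative (c≥0 k)}}

  Msum-lowerBound : ∀ {d r} (Δs : Fin r → LatticePolytope d) {b : Fin r → ℚ} {y : Pt d} →
    (∀ j {x} → x ∈conv Δs j → b j ≤ ⟨ x , y ⟩) → ∀ {x} → x ∈Msum Δs → sumℚ b ≤ ⟨ x , y ⟩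
  Msum-lowerBound Δs {y = y} b≤ (xs , xs∈ , refl) =
    ℚ.≤-trans (sumℚ-mono-≤ (λ j → b≤ j (xs∈ j))) (ℚ.≤-reflexive (sym (⟨⟩-sumPtˡ xs y)))

  axis : ∀ {d} → Fin d → ℚ → Pt d
  axis zero c = c ∷ zeroPt
  axis (suc k) c = 0ℚ ∷ axis k c

  ⟨⟩-axisˡ : ∀ {d} (k : Fin d) (c : ℚ) (y : Pt d) → ⟨ axis k c , y ⟩ ≡ c * lookup y k
  ⟨⟩-axisˡ zero c (b ∷ y) = trans (cong (c * b +_) (⟨⟩-zeroˡ y)) (ℚ.+-identityʳ _)
  ⟨⟩-axisˡ (suc k) c (b ∷ y) = trans (cong₂ _+_ (ℚ.*-zeroˡ b) (⟨⟩-axisˡ k c y)) (ℚ.+-identityˡ _)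

  axis-bounded : ∀ {d} (k : Fin d) {c ε : ℚ} → 0ℚ ≤ ε → ∣ c ∣ ≤ ε → ∀ k′ → ∣ lookup (axis k c) k′ ∣ ≤ ε
  axis-bounded zero 0≤ε ∣c∣≤ε zero = ∣c∣≤ε
  axis-bounded zero 0≤ε ∣c∣≤ε (suc k′) rewrite lookup-replicate k′ 0ℚ = 0≤ε
  axis-bounded (suc k) 0≤ε ∣c∣≤ε zero = 0≤ε
  axis-bounded (suc k) 0≤ε ∣c∣≤ε (suc k′) = axis-bounded k 0≤ε ∣c∣≤ε k′

  0≤±ε*a⇒a≡0 : ∀ {ε} a → 0ℚ < ε → 0ℚ ≤ ε * a → 0ℚ ≤ (- ε) * a → a ≡ 0ℚ
  0≤±ε*a⇒a≡0 {ε} a 0<ε 0≤ε*a 0≤-ε*a = ℚ.≤-antisym a≤0 0≤a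
    where
    instance
      ε-positive : Positive ε
      ε-positive = positive 0<ε
    0≤a : 0ℚ ≤ a
    0≤a = ℚ.*-cancelˡ-≤-pos ε (subst (_≤ ε * a) (sym (ℚ.*-zeroʳ ε)) 0≤ε*a)
    ε*a≤0 : ε * a ≤ 0ℚ
    ε*a≤0 = subst (_≤ 0ℚ) (⁻¹-involutive (ε * a))
      (ℚ.neg-antimono-≤ (subst (0ℚ ≤_) (sym (ℚ.neg-distribˡ-* ε a)) 0≤-ε*a))
    a≤0 : a ≤ 0ℚ
    a≤0 = ℚ.*-cancelˡ-≤-pos ε (subst (ε * a ≤_) (sym (ℚ.*-zeroʳ ε)) ε*a≤0)

  nonNegative-on-interior⇒zero : ∀ {d} {S : Pt d → Set} → ZeroInInterior S → (y : Pt d) →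
    (∀ x → S x → 0ℚ ≤ ⟨ x , y ⟩) → ∀ k → lookup y k ≡ 0ℚ
  nonNegative-on-interior⇒zero (ε , 0<ε , ball⊆S) y 0≤⟨⟩ k =
    0≤±ε*a⇒a≡0 (lookup y k) 0<ε (test ε ∣ε∣≡ε) (test (- ε) (trans (ℚ.∣-p∣≡∣p∣ ε) ∣ε∣≡ε))
    where
    0≤ε : 0ℚ ≤ ε
    0≤ε = ℚ.<⇒≤ 0<ε
    ∣ε∣≡ε : ∣ ε ∣ ≡ ε
    ∣ε∣≡ε = ℚ.0≤p⇒∣p∣≡p 0≤ε
    test : ∀ c → ∣ c ∣ ≡ ε → 0ℚ ≤ c * lookup y k
    test c ∣c∣≡ε = subst (0ℚ ≤_) (⟨⟩-axisˡ k c y)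
      (0≤⟨⟩ (axis k c) (ball⊆S (axis k c) (axis-bounded k 0≤ε (ℚ.≤-reflexive ∣c∣≡ε))))

-- Non-positive integers with sum at least -1
module _ where
  open import Data.Integer using (0ℤ; -1ℤ; 1ℤ; +0; +[1+_]; -[1+_]; _+_; _≤_; +≤+; -≤-)
  import Data.Integer.Properties as ℤ

  sumℤ : ∀ {r} → (Fin r → ℤ) → ℤ
  sumℤ {zero} f = 0ℤ
  sumℤ {suc r} f = f zero + sumℤ (λ j → f (suc j))

  sumℤ-nonPositive : ∀ {r} {f : Fin r → ℤ} → (∀ j → f j ≤ 0ℤ) → sumℤ f ≤ 0ℤ
  sumℤ-nonPositive {zero} _ = ℤ.≤-refl
  sumℤ-nonPositive {suc r} f≤0 = ℤ.+-mono-≤ (f≤0 zero) (sumℤ-nonPositive (f≤0 ∘ suc))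

  nonPositive∧sum≥0⇒zero : ∀ {r} {f : Fin r → ℤ} → (∀ j → f j ≤ 0ℤ) → 0ℤ ≤ sumℤ f → ∀ j → f j ≡ 0ℤ
  nonPositive∧sum≥0⇒zero {suc r} {f} f≤0 0≤Σ zero = ℤ.≤-antisym (f≤0 zero) (begin
    0ℤ                       ≤⟨ 0≤Σ ⟩
    f zero + sumℤ (f ∘ suc)  ≤⟨ ℤ.+-monoʳ-≤ (f zero) (sumℤ-nonPositive (f≤0 ∘ suc)) ⟩
    f zero + 0ℤ              ≡⟨ ℤ.+-identityʳ (f zero) ⟩
    f zero                   ∎)
    where open ℤ.≤-Reasoning
  nonPositive∧sum≥0⇒zero {suc r} {f} f≤0 0≤Σ (suc j) = nonPositive∧sum≥0⇒zero (f≤0 ∘ suc) (begin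
    0ℤ                       ≤⟨ 0≤Σ ⟩
    f zero + sumℤ (f ∘ suc)  ≤⟨ ℤ.+-monoˡ-≤ (sumℤ (f ∘ suc)) (f≤0 zero) ⟩
    0ℤ + sumℤ (f ∘ suc)      ≡⟨ ℤ.+-identityˡ _ ⟩
    sumℤ (f ∘ suc)           ∎) j
    where open ℤ.≤-Reasoning

  split-sum≥-1 : ∀ {a s} → a ≤ 0ℤ → s ≤ 0ℤ → -1ℤ ≤ a + s →
    (a ≡ 0ℤ × -1ℤ ≤ s) ⊎ (a ≡ -1ℤ × 0ℤ ≤ s)
  split-sum≥-1 {a} {s} a≤0 s≤0 -1≤a+s = cases a a≤0 -1≤a -1≤a+s
    where
    -1≤a : -1ℤ ≤ a
    -1≤a = ℤ.≤-trans -1≤a+s (ℤ.≤-trans (ℤ.+-monoʳ-≤ a s≤0) (ℤ.≤-reflexive (ℤ.+-identityʳ a)))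
    cases : ∀ a → a ≤ 0ℤ → -1ℤ ≤ a → -1ℤ ≤ a + s → (a ≡ 0ℤ × -1ℤ ≤ s) ⊎ (a ≡ -1ℤ × 0ℤ ≤ s)
    cases +0 _ _ -1≤0+s = inj₁ (refl , subst (-1ℤ ≤_) (ℤ.+-identityˡ s) -1≤0+s)
    cases +[1+ _ ] (+≤+ ()) _ _
    cases -[1+ 0 ] _ _ -1≤-1+s = inj₂ (refl , ℤ.≤-trans (ℤ.+-monoʳ-≤ 1ℤ -1≤-1+s)
      (ℤ.≤-reflexive (trans (sym (ℤ.+-assoc 1ℤ -1ℤ s)) (ℤ.+-identityˡ s))))
    cases -[1+ suc _ ] _ (-≤- ()) _

  nonPositive∧sum≥-1⇒zero⊎single : ∀ {r} (f : Fin r → ℤ) → (∀ j → f j ≤ 0ℤ) → -1ℤ ≤ sumℤ f →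
    (∀ j → f j ≡ 0ℤ) ⊎ ∃[ i ] (f i ≡ -1ℤ × (∀ j → ¬ i ≡ j → f j ≡ 0ℤ))
  nonPositive∧sum≥-1⇒zero⊎single {zero} f _ _ = inj₁ (λ ())
  nonPositive∧sum≥-1⇒zero⊎single {suc r} f f≤0 -1≤Σ
    with split-sum≥-1 (f≤0 zero) (sumℤ-nonPositive (f≤0 ∘ suc)) -1≤Σ
  ... | inj₂ (f0≡-1 , 0≤Σtail) = inj₂ (zero , f0≡-1 , λ
    { zero 0≢0 → ⊥-elim (0≢0 refl)
    ; (suc j) _ → nonPositive∧sum≥0⇒zero (f≤0 ∘ suc) 0≤Σtail j })
  ... | inj₁ (f0≡0 , -1≤Σtail) with nonPositive∧sum≥-1⇒zero⊎single (f ∘ suc) (f≤0 ∘ suc) -1≤Σtail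
  ...   | inj₁ tail≡0 = inj₁ λ { zero → f0≡0 ; (suc j) → tail≡0 j }
  ...   | inj₂ (i , fi≡-1 , others≡0) = inj₂ (suc i , fi≡-1 , λ
    { zero _ → f0≡0
    ; (suc j) si≢sj → others≡0 j (si≢sj ∘ cong suc) })

-- Lattice points
module _ where
  open import Data.Rational using (ℚ; mkℚ; 0ℚ; _/_; _+_; _*_; -_; _≤_; *≤*; ↥_)
  import Data.Rational.Properties as ℚ
  import Data.Integer as ℤ
  import Data.Integer.Properties as ℤ
  open import Data.Nat.Coprimality using (Coprime; 1-coprimeTo) renaming (sym to coprime-sym)

  fromℤ : ℤ → ℚ
  fromℤ z = z / 1

  private
    coprime-1 : ∀ n → Coprime n 1
    coprime-1 n = coprime-sym (1-coprimeTo n)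

    fromℤ-mkℚ : ∀ z → fromℤ z ≡ mkℚ z 0 (coprime-1 ℤ.∣ z ∣)
    fromℤ-mkℚ (ℤ.+ n) = ℚ.normalize-coprime (coprime-1 n)
    fromℤ-mkℚ ℤ.-[1+ n ] = cong -_ (ℚ.normalize-coprime (coprime-1 (suc n)))

  fromℤ-+ : ∀ a b → fromℤ a + fromℤ b ≡ fromℤ (a ℤ.+ b)
  fromℤ-+ a b rewrite fromℤ-mkℚ a | fromℤ-mkℚ b =
    cong (_/ 1) (cong₂ ℤ._+_ (ℤ.*-identityʳ a) (ℤ.*-identityʳ b))

  fromℤ-* : ∀ a b → fromℤ a * fromℤ b ≡ fromℤ (a ℤ.* b)
  fromℤ-* a b rewrite fromℤ-mkℚ a | fromℤ-mkℚ b = refl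

  fromℤ-mono-≤ : ∀ {a b} → a ℤ.≤ b → fromℤ a ≤ fromℤ b
  fromℤ-mono-≤ {a} {b} a≤b rewrite fromℤ-mkℚ a | fromℤ-mkℚ b =
    *≤* (subst₂ ℤ._≤_ (sym (ℤ.*-identityʳ a)) (sym (ℤ.*-identityʳ b)) a≤b)

  fromℤ-cancel-≤ : ∀ {a b} → fromℤ a ≤ fromℤ b → a ℤ.≤ b
  fromℤ-cancel-≤ {a} {b} fa≤fb rewrite fromℤ-mkℚ a | fromℤ-mkℚ b with fa≤fb
  ... | *≤* a*1≤b*1 = subst₂ ℤ._≤_ (ℤ.*-identityʳ a) (ℤ.*-identityʳ b) a*1≤b*1

  fromℤ-injective : ∀ {a b} → fromℤ a ≡ fromℤ b → a ≡ b
  fromℤ-injective {a} {b} fa≡fb = cong ↥_ (trans (sym (fromℤ-mkℚ a)) (trans fa≡fb (fromℤ-mkℚ b)))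

  dotℤ : ∀ {d} → LPt d → LPt d → ℤ
  dotℤ [] [] = ℤ.0ℤ
  dotℤ (a ∷ v) (b ∷ y) = a ℤ.* b ℤ.+ dotℤ v y

  ⟨⟩-toℚ : ∀ {d} (v y : LPt d) → ⟨ toℚ v , toℚ y ⟩ ≡ fromℤ (dotℤ v y)
  ⟨⟩-toℚ [] [] = refl
  ⟨⟩-toℚ (a ∷ v) (b ∷ y) = trans (cong₂ _+_ (fromℤ-* a b) (⟨⟩-toℚ v y)) (fromℤ-+ (a ℤ.* b) (dotℤ v y))

  sumℚ-fromℤ : ∀ {r} (f : Fin r → ℤ) → sumℚ (λ j → fromℤ (f j)) ≡ fromℤ (sumℤ f)
  sumℚ-fromℤ {zero} f = refl
  sumℚ-fromℤ {suc r} f = trans (cong (fromℤ (f zero) +_) (sumℚ-fromℤ (f ∘ suc))) (fromℤ-+ (f zero) _)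

  toℚ-vanishing⇒zero : ∀ {d} (y : LPt d) → (∀ k → lookup (toℚ y) k ≡ 0ℚ) → y ≡ replicate d ℤ.0ℤ
  toℚ-vanishing⇒zero [] _ = refl
  toℚ-vanishing⇒zero (a ∷ y) y≡0 = cong₂ _∷_ (fromℤ-injective (y≡0 zero)) (toℚ-vanishing⇒zero y (y≡0 ∘ suc))

-- Counting lists without duplicates
module _ where
  open import Data.Nat using (_+_)
  import Data.Nat.Properties as ℕ
  open import Data.Vec.Properties using (tabulate-cong)

  sumℕ-cong : ∀ {r} {f g : Fin r → ℕ} → (∀ i → f i ≡ g i) → sumℕ f ≡ sumℕ g
  sumℕ-cong h = cong (Data.Vec.foldr _ _+_ 0) (tabulate-cong h)

  sumℕ-suc : ∀ {r} (f : Fin r → ℕ) → sumℕ (λ i → suc (f i)) ≡ sumℕ f + r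
  sumℕ-suc {zero} f = refl
  sumℕ-suc {suc r} f = begin
    suc (f zero + sumℕ (λ i → suc (f (suc i)))) ≡⟨ cong (λ s → suc (f zero + s)) (sumℕ-suc (f ∘ suc)) ⟩
    suc (f zero + (sumℕ (f ∘ suc) + r))         ≡⟨ cong suc (ℕ.+-assoc (f zero) _ r) ⟨
    suc (f zero + sumℕ (f ∘ suc) + r)           ≡⟨ ℕ.+-suc _ r ⟨
    f zero + sumℕ (f ∘ suc) + suc r             ∎
    where open ≡-Reasoning

module _ {A : Set} where
  open import Data.Nat using (_+_)
  open import Data.List using (_++_)
  open import Data.List.Properties using (length-++)
  open import Data.List.Membership.Propositional using (_∈_)
  import Data.List.Membership.Propositional.Properties as ∈
  open import Data.List.Membership.Propositional.Properties.WithK using (unique∧set⇒bag)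
  open import Data.List.Relation.Binary.BagAndSetEquality using (∼bag⇒↭)
  open import Data.List.Relation.Binary.Permutation.Propositional.Properties using (↭-length)
  open import Data.List.Relation.Unary.Unique.Propositional using (Unique; [])
  import Data.List.Relation.Unary.Unique.Propositional.Properties as Unique
  open import Data.Fin.Properties using (suc-injective)
  open import Function.Bundles using (_⇔_)

  length-cong-∈ : {xs ys : List A} → Unique xs → Unique ys → (∀ {z} → z ∈ xs ⇔ z ∈ ys) →
    length xs ≡ length ys
  length-cong-∈ xs! ys! xs≈ys = ↭-length (∼bag⇒↭ (unique∧set⇒bag xs! ys! xs≈ys))

  concatFin : ∀ {r} → (Fin r → List A) → List A
  concatFin {zero} N = []
  concatFin {suc r} N = N zero ++ concatFin (N ∘ suc)

  length-concatFin : ∀ {r} (N : Fin r → List A) → length (concatFin N) ≡ sumℕ (λ i → length (N i))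
  length-concatFin {zero} N = refl
  length-concatFin {suc r} N =
    trans (length-++ (N zero)) (cong (length (N zero) +_) (length-concatFin (N ∘ suc)))

  ∈-concatFin⁺ : ∀ {r} (N : Fin r → List A) i {z} → z ∈ N i → z ∈ concatFin N
  ∈-concatFin⁺ {suc r} N zero z∈ = ∈.∈-++⁺ˡ z∈
  ∈-concatFin⁺ {suc r} N (suc i) z∈ = ∈.∈-++⁺ʳ (N zero) (∈-concatFin⁺ (N ∘ suc) i z∈)

  ∈-concatFin⁻ : ∀ {r} (N : Fin r → List A) {z} → z ∈ concatFin N → ∃[ i ] (z ∈ N i)
  ∈-concatFin⁻ {suc r} N z∈ with ∈.∈-++⁻ (N zero) z∈
  ... | inj₁ z∈N₀ = zero , z∈N₀
  ... | inj₂ z∈rest with ∈-concatFin⁻ (N ∘ suc) z∈rest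
  ...   | i , z∈Nᵢ = suc i , z∈Nᵢ

  concatFin-unique : ∀ {r} (N : Fin r → List A) → (∀ i → Unique (N i)) →
    (∀ {i j z} → ¬ i ≡ j → z ∈ N i → z ∈ N j → ⊥) → Unique (concatFin N)
  concatFin-unique {zero} N _ _ = []
  concatFin-unique {suc r} N N! disjoint =
    Unique.++⁺ (N! zero) (concatFin-unique (N ∘ suc) (N! ∘ suc) (λ i≢j → disjoint (i≢j ∘ suc-injective)))
      λ (z∈N₀ , z∈rest) → let i , z∈Nᵢ = ∈-concatFin⁻ (N ∘ suc) z∈rest in disjoint (λ ()) z∈N₀ z∈Nᵢ

module _ {A : Set} (_≟ₐ_ : DecidableEquality A) (o : A) where
  open import Data.Nat using (_+_)
  import Data.Nat.Properties as ℕ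
  open import Data.List using (filter)
  open import Data.List.Membership.Propositional using (_∈_)
  import Data.List.Membership.Propositional.Properties as ∈
  open import Data.List.Relation.Unary.Any using (here; there)
  import Data.List.Relation.Unary.All as All
  open import Data.List.Relation.Unary.Unique.Propositional using (Unique; _∷_)
  import Data.List.Relation.Unary.Unique.Propositional.Properties as Unique
  open import Function.Bundles using (mk⇔)
  open import Relation.Nullary using (¬?)

  punctured : List A → List A
  punctured = filter (λ z → ¬? (z ≟ₐ o))

  ∈-punctured⁺ : ∀ {xs z} → z ∈ xs → ¬ z ≡ o → z ∈ punctured xs
  ∈-punctured⁺ = ∈.∈-filter⁺ (λ z → ¬? (z ≟ₐ o))

  ∈-punctured⁻ : ∀ xs {z} → z ∈ punctured xs → z ∈ xs × ¬ z ≡ o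
  ∈-punctured⁻ xs = ∈.∈-filter⁻ (λ z → ¬? (z ≟ₐ o)) {xs = xs}

  punctured-unique : ∀ {xs} → Unique xs → Unique (punctured xs)
  punctured-unique = Unique.filter⁺ (λ z → ¬? (z ≟ₐ o))

  o∉punctured : ∀ xs {z} → z ∈ punctured xs → ¬ o ≡ z
  o∉punctured xs z∈ o≡z = proj₂ (∈-punctured⁻ xs z∈) (sym o≡z)

  length-punctured : {xs : List A} → Unique xs → o ∈ xs → length xs ≡ suc (length (punctured xs))
  length-punctured {xs} xs! o∈xs =
    length-cong-∈ xs! (All.tabulate (o∉punctured xs) ∷ punctured-unique xs!) (mk⇔ to from)
    where
    to : ∀ {z} → z ∈ xs → z ∈ o ∷ punctured xs
    to {z} z∈ with z ≟ₐ o
    ... | yes refl = here refl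
    ... | no z≢o = there (∈-punctured⁺ z∈ z≢o)
    from : ∀ {z} → z ∈ o ∷ punctured xs → z ∈ xs
    from (here refl) = o∈xs
    from (there z∈) = proj₁ (∈-punctured⁻ xs z∈)

  length-pointedUnion : ∀ {r} (D : List A) (N : Fin r → List A) → Unique D → (∀ i → Unique (N i)) →
    o ∈ D → (∀ i → o ∈ N i) → (∀ i {z} → z ∈ N i → z ∈ D) →
    (∀ {z} → z ∈ D → z ≡ o ⊎ ∃[ i ] (z ∈ N i)) →
    (∀ {i j z} → ¬ i ≡ j → z ∈ N i → z ∈ N j → z ≡ o) →
    length D + r ≡ sumℕ (λ i → length (N i)) + 1
  length-pointedUnion {r} D N D! N! o∈D o∈N N⊆D D⊆o∪N N∩N⊆o = begin
    length D + r                                ≡⟨ cong (_+ r) length-D ⟩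
    suc (sumℕ (length ∘ N°)) + r                ≡⟨ ℕ.+-comm 1 (sumℕ (length ∘ N°) + r) ⟩
    sumℕ (length ∘ N°) + r + 1                  ≡⟨ cong (_+ 1) (sumℕ-suc {r} (length ∘ N°)) ⟨
    sumℕ (λ i → suc (length (N° i))) + 1        ≡⟨ cong (_+ 1) (sumℕ-cong λ i → length-punctured (N! i) (o∈N i)) ⟨
    sumℕ (λ i → length (N i)) + 1               ∎
    where
    open ≡-Reasoning
    N° : Fin r → List A
    N° = punctured ∘ N
    to : ∀ {z} → z ∈ D → z ∈ o ∷ concatFin N°
    to {z} z∈D with z ≟ₐ o | D⊆o∪N z∈D
    ... | yes refl | _ = here refl
    ... | no z≢o | inj₁ z≡o = ⊥-elim (z≢o z≡o)
    ... | no z≢o | inj₂ (i , z∈Nᵢ) = there (∈-concatFin⁺ N° i (∈-punctured⁺ z∈Nᵢ z≢o))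
    from : ∀ {z} → z ∈ o ∷ concatFin N° → z ∈ D
    from (here refl) = o∈D
    from (there z∈) = let i , z∈N°ᵢ = ∈-concatFin⁻ N° z∈ in N⊆D i (proj₁ (∈-punctured⁻ (N i) z∈N°ᵢ))
    o∉concatN° : ∀ {z} → z ∈ concatFin N° → ¬ o ≡ z
    o∉concatN° z∈ = let i , z∈N°ᵢ = ∈-concatFin⁻ N° z∈ in o∉punctured (N i) z∈N°ᵢ
    concatN°-unique : Unique (concatFin N°)
    concatN°-unique = concatFin-unique N° (punctured-unique ∘ N!) λ {i} {j} i≢j z∈N°ᵢ z∈N°ⱼ →
      let z∈Nᵢ , z≢o = ∈-punctured⁻ (N i) z∈N°ᵢ in z≢o (N∩N⊆o i≢j z∈Nᵢ (proj₁ (∈-punctured⁻ (N j) z∈N°ⱼ)))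
    length-D : length D ≡ suc (sumℕ (length ∘ N°))
    length-D = trans (length-cong-∈ D! (All.tabulate o∉concatN° ∷ concatN°-unique) (mk⇔ to from))
      (cong suc (length-concatFin N°))

-- The dual nef-partition
module _ {d r : ℕ} (Δs : Fin r → LatticePolytope d) where
  open import Data.Rational using (ℚ; 0ℚ; 1ℚ; -_; _≤_)
  import Data.Rational.Properties as ℚ

  ∇⊆dual : ∀ i {y : Pt d} → y ∈∇[ i ] Δs → y ∈dual Δs
  ∇⊆dual i y∈∇ᵢ x x∈Δ = subst (_≤ _) -Σδ≡-1 (Msum-lowerBound Δs (λ j → y∈∇ᵢ j _) x∈Δ)
    where
    -Σδ≡-1 : sumℚ (λ j → - δ i j) ≡ - 1ℚ
    -Σδ≡-1 = trans (sumℚ-neg (δ i)) (cong -_ (sumℚ-δ i))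

  0∈∇ : ∀ i → zeroPt ∈∇[ i ] Δs
  0∈∇ i j x _ = subst (- δ i j ≤_) (sym (⟨⟩-zeroʳ x)) (ℚ.neg-antimono-≤ (0≤δ i j))

  0∈dual : zeroPt ∈dual Δs
  0∈dual x _ = subst (- 1ℚ ≤_) (sym (⟨⟩-zeroʳ x)) (ℚ.neg-antimono-≤ (ℚ.nonNegative⁻¹ 1ℚ))

  face-of-∇ : ∀ {i} {u y : Pt d} → u ∈conv Δs i → y ∈∇[ i ] Δs → ⟨ y , u ⟩ ≡ - 1ℚ →
    InFaceAvoidingOrigin y i Δs
  face-of-∇ {i} {u} u∈Δᵢ y∈∇ᵢ ⟨y,u⟩≡-1 = y∈∇ᵢ , u , - 1ℚ , supporting , ⟨y,u⟩≡-1 , misses-0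
    where
    supporting : ∀ y′ → y′ ∈∇[ i ] Δs → - 1ℚ ≤ ⟨ y′ , u ⟩
    supporting y′ y′∈∇ᵢ = subst₂ _≤_ (cong -_ (δ-diag i)) (⟨⟩-comm u y′) (y′∈∇ᵢ i u u∈Δᵢ)
    misses-0 : ¬ ⟨ zeroPt , u ⟩ ≡ - 1ℚ
    misses-0 ⟨0,u⟩≡-1 with trans (sym (⟨⟩-zeroˡ u)) ⟨0,u⟩≡-1
    ... | ()

module _ {d r : ℕ} (Δs : Fin r → LatticePolytope d) (nef : IsCenteredNefPartition Δs) where
  open import Data.Nat using (_+_)
  open import Data.Rational using (0ℚ; 1ℚ; -_; _≤_)
  import Data.Sum as Sum
  open import Data.Vec.Properties using (map-replicate; ≡-dec)
  open import Data.List.Membership.Propositional using (_∈_)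
  open import Function.Bundles using (_⇔_; Equivalence)
  open Equivalence using (to; from)
  import Data.Integer as ℤ
  open import Data.Integer using (0ℤ; -1ℤ)
  open import Data.Integer.Properties using (≤-totalOrder)
  open import Data.List using (allFin)
  open import Data.List.Membership.Propositional.Properties using (∈-allFin)
  import Data.List.Relation.Unary.All as All
  open import Data.List.Extrema ≤-totalOrder using (argmin; f[argmin]≤f[xs])

  private
    0∈Δ : ∀ j → zeroPt ∈conv Δs j
    0∈Δ = proj₁ nef

  toℚ-zero : toℚ (replicate d 0ℤ) ≡ zeroPt
  toℚ-zero = map-replicate _ 0ℤ d

  nonNegative⇒zero : (y : LPt d) → (∀ j {x} → x ∈conv Δs j → 0ℚ ≤ ⟨ x , toℚ y ⟩) → y ≡ replicate d 0ℤ
  nonNegative⇒zero y 0≤⟨⟩ = toℚ-vanishing⇒zero y (nonNegative-on-interior⇒zero (proj₁ (proj₂ nef)) (toℚ y)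
    λ x x∈Δ → subst (_≤ ⟨ x , toℚ y ⟩) (sumℚ-zero {r}) (Msum-lowerBound Δs 0≤⟨⟩ x∈Δ))

  ∇-disjoint : ∀ {i j} → ¬ i ≡ j → (y : LPt d) → toℚ y ∈∇[ i ] Δs → toℚ y ∈∇[ j ] Δs → y ≡ replicate d 0ℤ
  ∇-disjoint {i} {j} i≢j y y∈∇ᵢ y∈∇ⱼ = nonNegative⇒zero y 0≤⟨⟩
    where
    0≤⟨⟩ : ∀ k {x} → x ∈conv Δs k → 0ℚ ≤ ⟨ x , toℚ y ⟩
    0≤⟨⟩ k x∈Δₖ with i ≟ k
    ... | yes refl = subst (_≤ _) (cong -_ (δ-off (i≢j ∘ sym))) (y∈∇ⱼ i _ x∈Δₖ)
    ... | no i≢k = subst (_≤ _) (cong -_ (δ-off i≢k)) (y∈∇ᵢ k _ x∈Δₖ)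

  module _ (y : LPt d) where
    height : ∀ j → Fin (length (Δs j)) → ℤ
    height j k = dotℤ (List.lookup (Δs j) k) y

    lowest : ∀ j → Fin (length (Δs j))
    lowest j = argmin (height j) (someVertex (Δs j) (0∈Δ j)) (allFin _)

    lowest-minimal : ∀ j k → height j (lowest j) ℤ.≤ height j k
    lowest-minimal j k = All.lookup (f[argmin]≤f[xs] (someVertex (Δs j) (0∈Δ j)) (allFin _)) (∈-allFin k)

    lowestVertex : Fin r → LPt d
    lowestVertex j = List.lookup (Δs j) (lowest j)

    minHeight : Fin r → ℤ
    minHeight j = height j (lowest j)

    minHeight-lowerBound : ∀ j {x} → x ∈conv Δs j → fromℤ (minHeight j) ≤ ⟨ x , toℚ y ⟩
    minHeight-lowerBound j = conv-lowerBound (Δs j) λ k →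
      subst (fromℤ (minHeight j) ≤_) (sym (⟨⟩-toℚ (List.lookup (Δs j) k) y)) (fromℤ-mono-≤ (lowest-minimal j k))

    minHeight≤0 : ∀ j → minHeight j ℤ.≤ 0ℤ
    minHeight≤0 j = fromℤ-cancel-≤
      (subst (fromℤ (minHeight j) ≤_) (⟨⟩-zeroˡ (toℚ y)) (minHeight-lowerBound j (0∈Δ j)))

    dual⇒sum-minHeight≥-1 : toℚ y ∈dual Δs → -1ℤ ℤ.≤ sumℤ minHeight
    dual⇒sum-minHeight≥-1 y∈Δ* = fromℤ-cancel-≤ (subst (- 1ℚ ≤_) ⟨Σvertex,y⟩
      (y∈Δ* _ (toℚ ∘ lowestVertex , (λ j → lookup∈conv (Δs j) (lowest j)) , refl)))
      where
      ⟨Σvertex,y⟩ : ⟨ sumPt (toℚ ∘ lowestVertex) , toℚ y ⟩ ≡ fromℤ (sumℤ minHeight)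
      ⟨Σvertex,y⟩ = trans (⟨⟩-sumPtˡ (toℚ ∘ lowestVertex) (toℚ y))
        (trans (sumℚ-cong (λ j → ⟨⟩-toℚ (lowestVertex j) y)) (sumℚ-fromℤ minHeight))

    dual-lattice-point⇒zero⊎∇ : toℚ y ∈dual Δs →
      y ≡ replicate d 0ℤ ⊎ ∃[ i ] (toℚ y ∈∇[ i ] Δs × minHeight i ≡ -1ℤ)
    dual-lattice-point⇒zero⊎∇ y∈Δ* with nonPositive∧sum≥-1⇒zero⊎single minHeight minHeight≤0 (dual⇒sum-minHeight≥-1 y∈Δ*)
    ... | inj₁ min≡0 = inj₁ (nonNegative⇒zero y λ j x∈Δⱼ →
      subst (λ m → fromℤ m ≤ _) (min≡0 j) (minHeight-lowerBound j x∈Δⱼ))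
    ... | inj₂ (i , minᵢ≡-1 , min≡0) = inj₂ (i , y∈∇ᵢ , minᵢ≡-1)
      where
      y∈∇ᵢ : toℚ y ∈∇[ i ] Δs
      y∈∇ᵢ j x x∈Δⱼ with i ≟ j
      ... | yes refl = subst (_≤ _) (cong fromℤ minᵢ≡-1) (minHeight-lowerBound i x∈Δⱼ)
      ... | no i≢j = subst (_≤ _) (cong fromℤ (min≡0 j i≢j)) (minHeight-lowerBound j x∈Δⱼ)

    nonzero-dual-point-in-face : ¬ y ≡ replicate d 0ℤ → toℚ y ∈dual Δs →
      ∃[ i ] InFaceAvoidingOrigin (toℚ y) i Δs
    nonzero-dual-point-in-face y≢0 y∈Δ* with dual-lattice-point⇒zero⊎∇ y∈Δ*
    ... | inj₁ y≡0 = ⊥-elim (y≢0 y≡0)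
    ... | inj₂ (i , y∈∇ᵢ , minᵢ≡-1) = i , face-of-∇ Δs (lookup∈conv (Δs i) (lowest i)) y∈∇ᵢ
      (trans (⟨⟩-comm (toℚ y) (toℚ (lowestVertex i))) (trans (⟨⟩-toℚ (lowestVertex i) y) (cong fromℤ minᵢ≡-1)))

  lattice-point-count : (D : List (LPt d)) (Ns : Fin r → List (LPt d)) →
    Enumerates D (λ y → y ∈dual Δs) → (∀ i → Enumerates (Ns i) (λ y → y ∈∇[ i ] Δs)) →
    length D + r ≡ sumℕ (λ i → length (Ns i)) + 1
  lattice-point-count D Ns (D! , D≈) Ns≈ =
    length-pointedUnion (≡-dec ℤ._≟_) (replicate d 0ℤ) D Ns D! (proj₁ ∘ Ns≈)
      (from (D≈ _) (subst (_∈dual Δs) (sym toℚ-zero) (0∈dual Δs)))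
      (λ i → from (∇≈ i _) (subst (_∈∇[ i ] Δs) (sym toℚ-zero) (0∈∇ Δs i)))
      (λ i z∈Nᵢ → from (D≈ _) (∇⊆dual Δs i (to (∇≈ i _) z∈Nᵢ)))
      (λ z∈D → Sum.map₂ (λ (i , z∈∇ᵢ , _) → i , from (∇≈ i _) z∈∇ᵢ) (dual-lattice-point⇒zero⊎∇ _ (to (D≈ _) z∈D)))
      (λ i≢j z∈Nᵢ z∈Nⱼ → ∇-disjoint i≢j _ (to (∇≈ _ _) z∈Nᵢ) (to (∇≈ _ _) z∈Nⱼ))
    where
    ∇≈ : ∀ i (z : LPt d) → (z ∈ Ns i) ⇔ toℚ z ∈∇[ i ] Δs
    ∇≈ i = proj₂ (Ns≈ i)

open import Data.Nat using (_+_)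

corollary3p23 : ∀ {d r : ℕ} (Δs : Fin r → LatticePolytope d) → IsCenteredNefPartition Δs →
    (∀ (y : LPt d) → ¬ (y ≡ replicate d (ℤ.pos 0)) → toℚ y ∈dual Δs →
    ∃[ i ] InFaceAvoidingOrigin (toℚ y) i Δs)
    × (∀ (D : List (LPt d)) (Ns : Fin r → List (LPt d)) →
    Enumerates D (λ y → y ∈dual Δs) → (∀ i → Enumerates (Ns i) (λ y → y ∈∇[ i ] Δs)) →
    length D + r ≡ sumℕ (λ i → length (Ns i)) + 1)
corollary3p23 Δs nef = nonzero-dual-point-in-face Δs nef , lattice-point-count Δs nef
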